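{- Let $G=G([n],E)$ be a simple connected graph. Then the ideals $A_G$ and $T_G$ are Alexander dual to each other with respect to $\mathbf{d}_G+\mathbf{1}$, i.e. $A_G^{[\mathbf{d}_G+\mathbf{1}]}=T_G$ and $T_G^{[\mathbf{d}_G+\mathbf{1}]}=A_G$.
   Context: Work in $S=\mathbf{k}[x_1,\dots,x_n]$, $\mathbf{k}$ an infinite field; $\mathbf{x}^{\mathbf{a}}=\prod_i x_i^{a_i}$. $\mathbf{d}_G\in\mathbb{N}^{[n]}$ is the degree vector of $G$, $\mathbf{1}=(1,\dots,1)$, and $\mathbf{1}_\sigma=\sum_{i\in\sigma}e_i$. For an acyclic orientation $O$ of $G$ (every edge oriented, no directed cycle), $\mathrm{indeg}_O(i)$ is the number of edges directed into $i$. $A_G$ is the monomial ideal generated by $\prod_{i}x_i^{\mathrm{indeg}_O(i)+1}$ over all acyclic orientations $O$ of $G$. For $\sigma\subseteq[n]$ and $i\in\sigma$, let $\mathrm{deg}^{\mathrm{out}}_\sigma(i)=|\{j\in[n]\setminus\sigma:\{i,j\}\in E\}|$. $T_G$ is the monomial ideal generated by $\prod_{i\in\sigma}x_i^{\mathrm{deg}^{\mathrm{out}}_\sigma(i)+1}$ over all nonempty $\sigma\subseteq[n]$ with $G[\sigma]$ connected. For $\mathbf{b}\in\mathbb{N}^{[n]}$ let $\mathfrak{m}^{\mathbf{b}}=\langle x_i^{b_i}: b_i\ge1\rangle$. For $\mathbf{b}\preceq\mathbf{a}$ coordinatewise, $\mathbf{a}\setminus\mathbf{b}$ has $i$-th coordinate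 $a_i+1-b_i$ if $b_i\ge1$ and $0$ if $b_i=0$. If all minimal generators of a monomial ideal $I$ divide $\mathbf{x}^{\mathbf{a}}$, its Alexander dual with respect to $\mathbf{a}$ is $I^{[\mathbf{a}]}=\bigcap\{\mathfrak{m}^{\mathbf{a}\setminus\mathbf{b}}:\mathbf{x}^{\mathbf{b}}\text{ a minimal generator of }I\}$. -}

module Defs where

open import Data.Nat using (ℕ; zero; suc; _+_; _∸_; _≤_)
open import Data.Fin using (Fin; zero; suc)
open import Data.Bool using (Bool; true; false; if_then_else_)
open import Data.Product using (Σ; _×_; _,_; ∃)
open import Data.Sum using (_⊎_)
open import Relation.Binary.PropositionalEquality using (_≡_)
open import Relation.Nullary using (¬_)

-- Monomials and monomial ideals in S = k[x_1,...,x_n]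
-- A monomial x^a is its exponent vector a : Fin n → ℕ.
-- A monomial ideal is identified with the set of monomials it contains.

Mon : ℕ → Set
Mon n = Fin n → ℕ

MonIdeal : ℕ → Set₁
MonIdeal n = Mon n → Set

_∣ₘ_ : ∀ {n} → Mon n → Mon n → Set
a ∣ₘ b = ∀ i → a i ≤ b i

_≗ₘ_ : ∀ {n} → Mon n → Mon n → Set
a ≗ₘ b = ∀ i → a i ≡ b i

_≐_ : ∀ {n} → MonIdeal n → MonIdeal n → Set
I ≐ J = ∀ m → (I m → J m) × (J m → I m)

MinGen : ∀ {n} → MonIdeal n → Mon n → Set
MinGen I b = I b × (∀ c → I c → c ∣ₘ b → c ≗ₘ b)

-- m^b = < x_i^{b_i} : b_i ≥ 1 >
mIdeal : ∀ {n} → Mon n → MonIdeal n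
mIdeal b m = ∃ λ i → (1 ≤ b i) × (b i ≤ m i)

_∖ₘ_ : ∀ {n} → Mon n → Mon n → Mon n
(a ∖ₘ b) i with b i
... | zero  = 0
... | suc k = a i + 1 ∸ suc k

AlexDual : ∀ {n} → MonIdeal n → Mon n → MonIdeal n
AlexDual I a m = ∀ b → MinGen I b → mIdeal (a ∖ₘ b) m

record Graph (n : ℕ) : Set where
  field
    adj   : Fin n → Fin n → Bool
    sym   : ∀ i j → adj i j ≡ adj j i
    irrefl : ∀ i → adj i i ≡ false
open Graph public

countB : ∀ {n} → (Fin n → Bool) → ℕ
countB {zero} f = 0
countB {suc n} f = (if f zero then 1 else 0) + countB (λ j → f (suc j))

data Walk {n} (G : Graph n) (σ : Fin n → Bool) : Fin n → Fin n → Set where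
  here : ∀ {i} → σ i ≡ true → Walk G σ i i
  step : ∀ {i j k} → σ i ≡ true → adj G i j ≡ true → Walk G σ j k → Walk G σ i k

Connected : ∀ {n} → Graph n → Set
Connected G = ∀ i j → Walk G (λ _ → true) i j

InducedConnected : ∀ {n} → Graph n → (Fin n → Bool) → Set
InducedConnected G σ = ∀ i j → σ i ≡ true → σ j ≡ true → Walk G σ i j

degVec : ∀ {n} → Graph n → Mon n
degVec G i = countB (adj G i)

degVec+1 : ∀ {n} → Graph n → Mon n
degVec+1 G i = degVec G i + 1

-- Orientations: O i j ≡ true means the edge {i,j} is directed i → j.

record Orientation {n} (G : Graph n) : Set where
  field
    dir      : Fin n → Fin n → Bool
    onEdges  : ∀ i j → dir i j ≡ true → adj G i j ≡ true
    total    : ∀ i j → adj G i j ≡ true → (dir i j ≡ true) ⊎ (dir j i ≡ true)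
    antisym  : ∀ i j → dir i j ≡ true → dir j i ≡ false
open Orientation public

data Reach {n} {G : Graph n} (O : Orientation G) : Fin n → Fin n → Set where
  one  : ∀ {i j} → dir O i j ≡ true → Reach O i j
  more : ∀ {i j k} → dir O i j ≡ true → Reach O j k → Reach O i k

Acyclic : ∀ {n} {G : Graph n} → Orientation G → Set
Acyclic O = ∀ i → ¬ Reach O i i

indeg : ∀ {n} {G : Graph n} → Orientation G → Fin n → ℕ
indeg O i = countB (λ j → dir O j i)

A-ideal : ∀ {n} → Graph n → MonIdeal n
A-ideal G m = Σ (Orientation G) λ O → Acyclic O × ((λ i → indeg O i + 1) ∣ₘ m)

degOut : ∀ {n} → Graph n → (Fin n → Bool) → Fin n → ℕ
degOut G σ i = countB (λ j → if σ j then false else adj G i j)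

T-gen : ∀ {n} → Graph n → (Fin n → Bool) → Mon n
T-gen G σ i = if σ i then degOut G σ i + 1 else 0

T-ideal : ∀ {n} → Graph n → MonIdeal n
T-ideal G m = Σ (Fin _ → Bool) λ σ →
  (∃ λ i → σ i ≡ true) × InducedConnected G σ × (T-gen G σ ∣ₘ m)

module Submission where

-- The minimal generators of A_G are x^(indeg_O + 1) for acyclic orientations O,
-- with dual exponent outdeg_O(i) + 1 at i; those of T_G are T-gen σ for nonempty
-- σ with G[σ] connected, with dual exponent |N(i) ∩ σ| + 1 at i ∈ σ.
-- * T_G ⊆ A_G^[a] and A_G ⊆ T_G^[a]: O has a sink s in σ, and at s
--   outdeg_O(s) ≤ deg^out_σ(s) and |N(s) ∩ σ| ≤ indeg_O(s).
-- * A_G^[a] ⊆ T_G and T_G^[a] ⊆ A_G: given x^m, greedily peel off vertices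
--   satisfying an exponent condition.  A complete peeling ranks the vertices and
--   so orients G acyclically; otherwise a nonempty blocking set remains, whose
--   connected components are candidates σ.  One alternative contradicts the
--   hypothesis on m, the other yields a generator dividing x^m.

open import Defs hiding (sym)
open import Data.Nat using (ℕ; zero; suc; _+_; _∸_; _≤_; _<_; z≤n; s≤s; _≤?_; _<ᵇ_)
open import Data.Nat.Properties hiding (_≟_)
open import Data.Fin using (Fin; zero; suc)
open import Data.Fin.Properties using (_≟_; any?)
open import Data.Bool using (Bool; true; false; if_then_else_; _∧_; _∨_)
open import Data.Bool.Properties using (∧-conicalˡ; ∧-conicalʳ; ¬-not; T-≡)
import Data.Bool.Properties as Bool
open import Data.Product using (Σ; ∃; _×_; _,_; proj₁; proj₂)
open import Data.Sum using (_⊎_; inj₁; inj₂)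
open import Data.Empty using (⊥; ⊥-elim)
open import Function using (_∘_; Equivalence)
open import Relation.Nullary using (¬_; Dec; yes; no; does)
open import Relation.Nullary.Decidable using (dec-true; dec-false; _×-dec_)
open import Relation.Binary.Definitions using (tri<; tri≈; tri>)
open import Relation.Binary.PropositionalEquality
  using (_≡_; refl; sym; trans; cong; cong₂; subst; subst₂; module ≡-Reasoning)
open import Algebra.Properties.CommutativeMonoid.Sum +-0-commutativeMonoid
  using (sum; ∑-distrib-+; ∑-comm; sum-cong-≗)

Sub : ℕ → Set
Sub n = Fin n → Bool

_⊆_ : ∀ {n} → Sub n → Sub n → Set
S ⊆ S′ = ∀ j → S j ≡ true → S′ j ≡ true

true≢false : ∀ {b} → b ≡ true → b ≡ false → ⊥
true≢false refl ()

∧-intro : ∀ {a b} → a ≡ true → b ≡ true → a ∧ b ≡ true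
∧-intro refl q = q

∨-introˡ : ∀ {a} b → a ≡ true → a ∨ b ≡ true
∨-introˡ b refl = refl

∨-introʳ : ∀ a {b} → b ≡ true → a ∨ b ≡ true
∨-introʳ true  _ = refl
∨-introʳ false q = q

∨-elim : ∀ a {b} → a ∨ b ≡ true → a ≡ true ⊎ b ≡ true
∨-elim true  _ = inj₁ refl
∨-elim false q = inj₂ q

bool-ext : ∀ {x y} → (x ≡ true → y ≡ true) → (y ≡ true → x ≡ true) → x ≡ y
bool-ext {false} {false} _ _ = refl
bool-ext {false} {true}  _ g = g refl
bool-ext {true}          f _ = sym (f refl)

if-same : ∀ {A : Set} {x : A} b → (if b then x else x) ≡ x
if-same true  = refl
if-same false = refl

some : ∀ {n} → Sub n → Bool
some {zero}  f = false
some {suc n} f = f zero ∨ some (f ∘ suc)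

some-sound : ∀ {n} (f : Sub n) → some f ≡ true → ∃ λ j → f j ≡ true
some-sound {suc n} f e with ∨-elim (f zero) e
... | inj₁ f0 = zero , f0
... | inj₂ rest with some-sound (f ∘ suc) rest
...   | j , fj = suc j , fj

some-complete : ∀ {n} (f : Sub n) j → f j ≡ true → some f ≡ true
some-complete f zero    fj = ∨-introˡ _ fj
some-complete f (suc j) fj = ∨-introʳ (f zero) (some-complete (f ∘ suc) j fj)

⟦_⟧ : ∀ {n} → Fin n → Sub n
⟦ i ⟧ j = does (j ≟ i)

remove : ∀ {n} → Sub n → Fin n → Sub n
remove S i j = if does (j ≟ i) then false else S j

remove-keeps : ∀ {n} (S : Sub n) {i j} → ¬ j ≡ i → S j ≡ true → remove S i j ≡ true
remove-keeps S {i} {j} j≢i Sj =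
  subst (λ b → (if b then false else S j) ≡ true) (sym (dec-false (j ≟ i) j≢i)) Sj

toN : Bool → ℕ
toN b = if b then 1 else 0

toN-mono : ∀ {a b} → (a ≡ true → b ≡ true) → toN a ≤ toN b
toN-mono {false} _ = z≤n
toN-mono {true}  h rewrite h refl = ≤-refl

countB-cong : ∀ {n} {f g : Sub n} → (∀ j → f j ≡ g j) → countB f ≡ countB g
countB-cong {zero}  _ = refl
countB-cong {suc n} e = cong₂ (λ b c → toN b + c) (e zero) (countB-cong (e ∘ suc))

countB-mono : ∀ {n} {f g : Sub n} → f ⊆ g → countB f ≤ countB g
countB-mono {zero}  _ = z≤n
countB-mono {suc n} h = +-mono-≤ (toN-mono (h zero)) (countB-mono (λ j → h (suc j)))

countB-strict : ∀ {n} {f g : Sub n} → f ⊆ g → ∀ k → f k ≡ false → g k ≡ true →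
  countB f < countB g
countB-strict h zero fk gk rewrite fk | gk = s≤s (countB-mono (λ j → h (suc j)))
countB-strict h (suc k) fk gk =
  +-mono-≤-< (toN-mono (h zero)) (countB-strict (λ j → h (suc j)) k fk gk)

countB-grow : ∀ {n} {f g : Sub n} → f ⊆ g → g ⊆ f ⊎ countB f < countB g
countB-grow {zero} _ = inj₁ (λ ())
countB-grow {suc n} {f} {g} h with countB-grow {f = f ∘ suc} {g ∘ suc} (λ j → h (suc j))
... | inj₂ lt = inj₂ (+-mono-≤-< (toN-mono (h zero)) lt)
... | inj₁ tail⊆ with f zero in f0 | g zero in g0
...   | false | true  = inj₂ (s≤s (countB-mono (λ j → h (suc j))))
...   | true  | _     = inj₁ λ { zero _ → f0 ; (suc j) gj → tail⊆ j gj }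
...   | false | false = inj₁ λ { zero g0′ → ⊥-elim (true≢false g0′ g0) ; (suc j) gj → tail⊆ j gj }

countB-all : ∀ {n} → countB {n} (λ _ → true) ≡ n
countB-all {zero}  = refl
countB-all {suc n} = cong suc (countB-all {n})

countB-≤ : ∀ {n} (f : Sub n) → countB f ≤ n
countB-≤ {n} f = subst (countB f ≤_) (countB-all {n}) (countB-mono {f = f} (λ _ _ → refl))

countB-missing : ∀ {n} (f : Sub n) k → f k ≡ false → countB f < n
countB-missing {n} f k fk =
  subst (countB f <_) (countB-all {n}) (countB-strict (λ _ _ → refl) k fk refl)

countB-pos : ∀ {n} (f : Sub n) k → f k ≡ true → 0 < countB f
countB-pos f zero    fk rewrite fk = s≤s z≤n
countB-pos f (suc k) fk = ≤-trans (countB-pos (f ∘ suc) k fk) (m≤n+m _ (toN (f zero)))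

countB-witness : ∀ {n} (f : Sub n) → 0 < countB f → ∃ λ j → f j ≡ true
countB-witness {suc n} f pos with f zero in f0
... | true  = zero , f0
... | false with countB-witness (f ∘ suc) pos
...   | j , fj = suc j , fj

countB-remove : ∀ {n} (S : Sub n) i → S i ≡ true → countB S ≡ suc (countB (remove S i))
countB-remove S zero Si rewrite Si = refl
countB-remove S (suc i) Si =
  trans (cong (toN (S zero) +_) (countB-remove (S ∘ suc) i Si)) (+-suc (toN (S zero)) _)

countB-sum : ∀ {n} (f : Sub n) → countB f ≡ sum (toN ∘ f)
countB-sum {zero}  f = refl
countB-sum {suc n} f = cong (toN (f zero) +_) (countB-sum (f ∘ suc))

countB-split : ∀ {n} (h f g : Sub n) → (∀ j → toN (h j) ≡ toN (f j) + toN (g j)) →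
  countB h ≡ countB f + countB g
countB-split h f g pointwise = begin
  countB h                         ≡⟨ countB-sum h ⟩
  sum (toN ∘ h)                    ≡⟨ sum-cong-≗ pointwise ⟩
  sum (λ j → toN (f j) + toN (g j)) ≡⟨ ∑-distrib-+ (toN ∘ f) (toN ∘ g) ⟩
  sum (toN ∘ f) + sum (toN ∘ g)    ≡⟨ sym (cong₂ _+_ (countB-sum f) (countB-sum g)) ⟩
  countB f + countB g              ∎
  where open ≡-Reasoning

sum-mono : ∀ {n} {f g : Fin n → ℕ} → (∀ i → f i ≤ g i) → sum f ≤ sum g
sum-mono {zero}  _  = z≤n
sum-mono {suc n} le = +-mono-≤ (le zero) (sum-mono (le ∘ suc))

sum-rigid : ∀ {n} (f g : Fin n → ℕ) → (∀ i → f i ≤ g i) → sum f ≡ sum g → ∀ i → f i ≡ g i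
sum-rigid {suc n} f g le total = pointwise
  where
  heads : f zero ≡ g zero
  heads = ≤-antisym (le zero) (+-cancelʳ-≤ (sum (f ∘ suc)) _ _ (begin
    g zero + sum (f ∘ suc) ≤⟨ +-monoʳ-≤ (g zero) (sum-mono (le ∘ suc)) ⟩
    g zero + sum (g ∘ suc) ≡⟨ sym total ⟩
    f zero + sum (f ∘ suc) ∎))
    where open ≤-Reasoning
  tails : sum (f ∘ suc) ≡ sum (g ∘ suc)
  tails = +-cancelˡ-≡ (f zero) _ _ (trans total (cong (_+ sum (g ∘ suc)) (sym heads)))
  pointwise : ∀ i → f i ≡ g i
  pointwise zero    = heads
  pointwise (suc i) = sum-rigid (f ∘ suc) (g ∘ suc) (le ∘ suc) tails i

+-double-injective : ∀ {x y} → x + x ≡ y + y → x ≡ y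
+-double-injective {x} {y} e with <-cmp x y
... | tri< x<y _ _ = ⊥-elim (<-irrefl e (+-mono-< x<y x<y))
... | tri≈ _ x≡y _ = x≡y
... | tri> _ _ y<x = ⊥-elim (<-irrefl (sym e) (+-mono-< y<x y<x))

module _ {n} {G : Graph n} where

  walk-start : ∀ {σ i j} → Walk G σ i j → σ i ≡ true
  walk-start (here s)     = s
  walk-start (step s _ _) = s

  walk-snoc : ∀ {σ i l j} → Walk G σ i l → adj G l j ≡ true → σ j ≡ true → Walk G σ i j
  walk-snoc (here s)     a σj = step s a (here σj)
  walk-snoc (step s b w) a σj = step s b (walk-snoc w a σj)

  walk-reverse : ∀ {σ i j} → Walk G σ i j → Walk G σ j i
  walk-reverse (here s) = here s
  walk-reverse {i = i} (step {j = j} s a w) =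
    walk-snoc (walk-reverse w) (trans (Graph.sym G j i) a) s

  walk-append : ∀ {σ i j k} → Walk G σ i j → Walk G σ j k → Walk G σ i k
  walk-append (here _)     w′ = w′
  walk-append (step s a w) w′ = step s a (walk-append w w′)

  walk-mono : ∀ {σ τ i j} → σ ⊆ τ → Walk G σ i j → Walk G τ i j
  walk-mono h (here s)     = here (h _ s)
  walk-mono h (step s a w) = step (h _ s) a (walk-mono h w)

  ExitEdge : Sub n → Sub n → Set
  ExitEdge σ σ′ = Σ (Fin n) λ u → Σ (Fin n) λ v →
    σ′ u ≡ true × σ′ v ≡ false × σ v ≡ true × adj G u v ≡ true

  walk-exit : ∀ {σ σ′ x y} → Walk G σ x y → σ′ x ≡ true → σ′ y ≡ false → ExitEdge σ σ′
  walk-exit (here _) σ′x σ′y = ⊥-elim (true≢false σ′x σ′y)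
  walk-exit {σ′ = σ′} (step {j = j} _ a w) σ′x σ′y with σ′ j in σ′j
  ... | true  = walk-exit w σ′j σ′y
  ... | false = _ , j , σ′x , σ′j , walk-start w , a

-- Iterating an inflationary monotone operator on vertex sets reaches a
-- fixed point after n + 1 steps: each non-stable step adds a vertex.

module Closure {n} (F : Sub n → Sub n)
  (inflationary : ∀ S → S ⊆ F S) (monotone : ∀ {S S′} → S ⊆ S′ → F S ⊆ F S′) where

  iter : ℕ → Sub n → Sub n
  iter zero    S = S
  iter (suc k) S = F (iter k S)

  iter-inflationary : ∀ k S → S ⊆ iter k S
  iter-inflationary zero    S j Sj = Sj
  iter-inflationary (suc k) S j Sj = inflationary (iter k S) j (iter-inflationary k S j Sj)

  stable-or-large : ∀ k S → F (iter k S) ⊆ iter k S ⊎ k ≤ countB (iter k S)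
  stable-or-large zero    S = inj₂ z≤n
  stable-or-large (suc k) S with stable-or-large k S
  ... | inj₁ stable = inj₁ (monotone stable)
  ... | inj₂ large with countB-grow (inflationary (iter k S))
  ...   | inj₁ stable = inj₁ (monotone stable)
  ...   | inj₂ larger = inj₂ (≤-trans (s≤s large) larger)

  fixed-point : ∀ S → F (iter (suc n) S) ⊆ iter (suc n) S
  fixed-point S with stable-or-large (suc n) S
  ... | inj₁ stable = stable
  ... | inj₂ large  = ⊥-elim (<-irrefl refl (≤-trans large (countB-≤ (iter (suc n) S))))

module Component {n} (G : Graph n) (V : Sub n) (i₀ : Fin n) (Vi₀ : V i₀ ≡ true) where

  touches : Sub n → Fin n → Bool
  touches S j = some (λ l → S l ∧ adj G l j)

  touches-sound : ∀ S j → touches S j ≡ true → ∃ λ l → S l ≡ true × adj G l j ≡ true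
  touches-sound S j e with some-sound _ e
  ... | l , Sl∧a = l , ∧-conicalˡ _ _ Sl∧a , ∧-conicalʳ (S l) _ Sl∧a

  touches-complete : ∀ S {l j} → S l ≡ true → adj G l j ≡ true → touches S j ≡ true
  touches-complete S {l} {j} Sl a = some-complete (λ l → S l ∧ adj G l j) l (∧-intro Sl a)

  grow : Sub n → Sub n
  grow S j = S j ∨ (V j ∧ touches S j)

  grow-inflationary : ∀ S → S ⊆ grow S
  grow-inflationary S j Sj = ∨-introˡ _ Sj

  grow-monotone : ∀ {S S′} → S ⊆ S′ → grow S ⊆ grow S′
  grow-monotone {S} {S′} h j e with ∨-elim (S j) e
  ... | inj₁ Sj  = ∨-introˡ _ (h j Sj)
  ... | inj₂ new with touches-sound S j (∧-conicalʳ (V j) _ new)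
  ...   | l , Sl , a =
    ∨-introʳ (S′ j) (∧-intro (∧-conicalˡ (V j) _ new) (touches-complete S′ (h l Sl) a))

  open Closure grow grow-inflationary grow-monotone

  -- stage k: the vertices of V reachable from i₀ by a walk of length ≤ k in G[V].
  stage : ℕ → Sub n
  stage k = iter k ⟦ i₀ ⟧

  component : Sub n
  component = stage (suc n)

  stage⊆V : ∀ k → stage k ⊆ V
  stage⊆V zero j e with j ≟ i₀
  ... | yes refl = Vi₀
  stage⊆V (suc k) j e with ∨-elim (stage k j) e
  ... | inj₁ old = stage⊆V k j old
  ... | inj₂ new = ∧-conicalˡ (V j) _ new

  stage-walk : ∀ k j → stage k j ≡ true → Walk G (stage k) i₀ j
  stage-walk zero j e with j ≟ i₀
  ... | yes refl = here (dec-true (i₀ ≟ i₀) refl)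
  stage-walk (suc k) j e with ∨-elim (stage k j) e
  ... | inj₁ old = walk-mono (grow-inflationary (stage k)) (stage-walk k j old)
  ... | inj₂ new with touches-sound (stage k) j (∧-conicalʳ (V j) _ new)
  ...   | l , Sl , a = walk-snoc (walk-mono (grow-inflationary (stage k)) (stage-walk k l Sl)) a e

  component⊆V : component ⊆ V
  component⊆V = stage⊆V (suc n)

  i₀∈component : component i₀ ≡ true
  i₀∈component = iter-inflationary (suc n) ⟦ i₀ ⟧ i₀ (dec-true (i₀ ≟ i₀) refl)

  component-connected : InducedConnected G component
  component-connected i j σi σj =
    walk-append (walk-reverse (stage-walk (suc n) i σi)) (stage-walk (suc n) j σj)

  component-closed : ∀ {i j} → component i ≡ true → V j ≡ true → adj G i j ≡ true →
    component j ≡ true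
  component-closed {j = j} σi Vj a =
    fixed-point ⟦ i₀ ⟧ j (∨-introʳ (component j) (∧-intro Vj (touches-complete component σi a)))

  component-agrees : ∀ {i j} → component i ≡ true → adj G i j ≡ true → component j ≡ V j
  component-agrees {i} {j} σi a = bool-ext (component⊆V j) (λ Vj → component-closed σi Vj a)

IsSink : ∀ {n} {G : Graph n} → Orientation G → Sub n → Fin n → Set
IsSink O σ s = σ s ≡ true × (∀ j → σ j ≡ true → dir O s j ≡ false)

module _ {n} {G : Graph n} (O : Orientation G) (acyclic : Acyclic O) where

  reach-snoc : ∀ {u c j} → Reach O u c → dir O c j ≡ true → Reach O u j
  reach-snoc (one d)    d′ = more d (one d′)
  reach-snoc (more d r) d′ = more d (reach-snoc r d′)

  unvisited : ∀ (S : Sub n) cur → (∀ u → S u ≡ true → Reach O u cur) → S cur ≡ false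
  unvisited S cur reaches = ¬-not (λ Scur → acyclic cur (reaches cur Scur))

  -- Follow arcs inside σ from cur, remembering the visited set S, all of whose
  -- members reach cur.  By acyclicity cur ∉ S, so S grows at every move and
  -- the walk reaches a sink within n moves.
  sink-search : ∀ σ fuel (S : Sub n) cur → σ cur ≡ true →
    (∀ u → S u ≡ true → Reach O u cur) → n ≤ countB S + fuel → ∃ (IsSink O σ)
  sink-search σ fuel S cur σcur reaches budget
    with any? (λ j → (σ j Bool.≟ true) ×-dec (dir O cur j Bool.≟ true))
  ... | no none = cur , σcur , λ j σj → ¬-not (λ arc → none (j , σj , arc))
  ... | yes (next , σnext , arc) with fuel
  ...   | zero = ⊥-elim (<⇒≱ (countB-missing S cur (unvisited S cur reaches))
                            (subst (n ≤_) (+-identityʳ _) budget))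
  ...   | suc fuel′ = sink-search σ fuel′ visited next σnext reaches′ budget′
    where
    visited : Sub n
    visited u = S u ∨ ⟦ cur ⟧ u
    reaches′ : ∀ u → visited u ≡ true → Reach O u next
    reaches′ u e with u ≟ cur
    ... | yes refl = one arc
    ... | no _ with ∨-elim (S u) e
    ...   | inj₁ Su = reach-snoc (reaches u Su) arc
    budget′ : n ≤ countB visited + fuel′
    budget′ = ≤-trans budget (≤-trans (≤-reflexive (+-suc (countB S) fuel′))
      (+-monoˡ-≤ fuel′ (countB-strict (λ u Su → ∨-introˡ _ Su) cur (unvisited S cur reaches)
        (∨-introʳ (S cur) (dec-true (cur ≟ cur) refl)))))

  sink : ∀ σ i → σ i ≡ true → ∃ (IsSink O σ)
  sink σ i σi = sink-search σ n (λ _ → false) i σi (λ _ ()) (m≤n+m n _)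

-- P V i says that i may be removed from the current vertex
-- set V.  Repeatedly removing some removable vertex either empties the
-- vertex set, which ranks the vertices by removal time, or gets stuck at a
-- nonempty set none of whose vertices is removable.

module Peeling {n : ℕ} (P : Sub n → Fin n → Set) (P? : ∀ V i → Dec (P V i)) where

  Blocking : Sub n → Set
  Blocking V = (∃ λ i → V i ≡ true) × (∀ i → V i ≡ true → ¬ P V i)

  record PeelingOrder (U : Sub n) (k : ℕ) : Set where
    field
      rank      : Fin n → ℕ
      bounded   : ∀ i → U i ≡ true → rank i < k
      injective : ∀ i j → U i ≡ true → U j ≡ true → rank i ≡ rank j → i ≡ j
      peel      : ∀ i → U i ≡ true → Σ (Sub n) λ V →
                    (∀ j → U j ≡ true → rank j ≤ rank i → V j ≡ true) × P V i

  empty-order : ∀ U → countB U ≡ 0 → PeelingOrder U 0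
  empty-order U empty = record
    { rank = λ _ → 0 ; bounded = λ i Ui → absurd i Ui ; injective = λ i _ Ui → absurd i Ui
    ; peel = λ i Ui → absurd i Ui }
    where
    absurd : ∀ {A : Set} i → U i ≡ true → A
    absurd i Ui = ⊥-elim (<-irrefl (sym empty) (countB-pos U i Ui))

  extend : ∀ {U k} i → U i ≡ true → P U i → PeelingOrder (remove U i) k →
    PeelingOrder U (suc k)
  extend {U} {k} i Ui Pi order = record
    { rank = rank ; bounded = bounded ; injective = injective ; peel = peel }
    where
    module Old = PeelingOrder order

    rank : Fin n → ℕ
    rank j = if does (j ≟ i) then k else Old.rank j

    bounded : ∀ j → U j ≡ true → rank j < suc k
    bounded j Uj with j ≟ i
    ... | yes _   = ≤-refl
    ... | no  j≢i = m<n⇒m<1+n (Old.bounded j (remove-keeps U j≢i Uj))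

    injective : ∀ j l → U j ≡ true → U l ≡ true → rank j ≡ rank l → j ≡ l
    injective j l Uj Ul same with j ≟ i | l ≟ i
    ... | yes refl | yes refl = refl
    ... | yes refl | no  l≢i  = ⊥-elim (<-irrefl (sym same) (Old.bounded l (remove-keeps U l≢i Ul)))
    ... | no  j≢i  | yes refl = ⊥-elim (<-irrefl same (Old.bounded j (remove-keeps U j≢i Uj)))
    ... | no  j≢i  | no  l≢i  =
      Old.injective j l (remove-keeps U j≢i Uj) (remove-keeps U l≢i Ul) same

    peel : ∀ j → U j ≡ true → Σ (Sub n) λ V →
      (∀ l → U l ≡ true → rank l ≤ rank j → V l ≡ true) × P V j
    peel j Uj with j ≟ i
    ... | yes refl = U , (λ l Ul _ → Ul) , Pi
    ... | no  j≢i with Old.peel j (remove-keeps U j≢i Uj)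
    ...   | V , below⊆V , PVj = V , below⊆V′ , PVj
      where
      below⊆V′ : ∀ l → U l ≡ true → rank l ≤ Old.rank j → V l ≡ true
      below⊆V′ l Ul le with l ≟ i
      ... | yes refl = ⊥-elim (<-irrefl refl (≤-<-trans le (Old.bounded j (remove-keeps U j≢i Uj))))
      ... | no  l≢i  = below⊆V l (remove-keeps U l≢i Ul) le

  peel-or-block : ∀ k U → countB U ≡ k → Σ (Sub n) Blocking ⊎ PeelingOrder U k
  peel-or-block zero U empty = inj₂ (empty-order U empty)
  peel-or-block (suc k) U size with any? (λ i → (U i Bool.≟ true) ×-dec P? U i)
  ... | no stuck = inj₁ (U , countB-witness U (subst (0 <_) (sym size) (s≤s z≤n)) ,
                            λ i Ui Pi → stuck (i , Ui , Pi))
  ... | yes (i , Ui , Pi)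
    with peel-or-block k (remove U i) (suc-injective (trans (sym (countB-remove U i Ui)) size))
  ...   | inj₁ blocking = inj₁ blocking
  ...   | inj₂ order    = inj₂ (extend i Ui Pi order)

  peeling : Σ (Sub n) Blocking ⊎ PeelingOrder (λ _ → true) n
  peeling = peel-or-block n (λ _ → true) countB-all

-- An injective ranking orients every edge from lower to higher rank; the
-- orientation is acyclic because ranks increase along arcs.

<ᵇ-sound : ∀ m k → (m <ᵇ k) ≡ true → m < k
<ᵇ-sound m k e = <ᵇ⇒< m k (Equivalence.from T-≡ e)

<ᵇ-complete : ∀ {m k} → m < k → (m <ᵇ k) ≡ true
<ᵇ-complete lt = Equivalence.to T-≡ (<⇒<ᵇ lt)

module RankOrientation {n} (G : Graph n) (rank : Fin n → ℕ)
  (injective : ∀ i j → rank i ≡ rank j → i ≡ j) where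

  arc-rank : ∀ {i j} → adj G i j ∧ (rank i <ᵇ rank j) ≡ true → rank i < rank j
  arc-rank {i} {j} e = <ᵇ-sound (rank i) (rank j) (∧-conicalʳ (adj G i j) _ e)

  orient : ∀ i j → adj G i j ≡ true →
    (adj G i j ∧ (rank i <ᵇ rank j) ≡ true) ⊎ (adj G j i ∧ (rank j <ᵇ rank i) ≡ true)
  orient i j a with <-cmp (rank i) (rank j)
  ... | tri< lt _ _ = inj₁ (∧-intro a (<ᵇ-complete lt))
  ... | tri≈ _ eq _ = ⊥-elim (true≢false (subst (λ x → adj G i x ≡ true) (sym (injective i j eq)) a)
                                          (Graph.irrefl G i))
  ... | tri> _ _ gt = inj₂ (∧-intro (trans (Graph.sym G j i) a) (<ᵇ-complete gt))

  byRank : Orientation G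
  byRank = record
    { dir     = λ i j → adj G i j ∧ (rank i <ᵇ rank j)
    ; onEdges = λ i j e → ∧-conicalˡ _ _ e
    ; total   = orient
    ; antisym = λ i j e → ¬-not (λ e′ → <-asym (arc-rank e) (arc-rank e′))
    }

  reach-rank : ∀ {i j} → Reach byRank i j → rank i < rank j
  reach-rank (one d)    = arc-rank d
  reach-rank (more d r) = <-trans (arc-rank d) (reach-rank r)

  byRank-acyclic : Acyclic byRank
  byRank-acyclic i r = <-irrefl refl (reach-rank r)

dual-exponent : ∀ {n} (a b : Mon n) i {x y} → a i ≡ x + y + 1 → b i ≡ x + 1 →
  (a ∖ₘ b) i ≡ y + 1
dual-exponent a b i {x} {y} ai bi with b i
... | zero  = ⊥-elim (0≢1+n (trans bi (+-comm x 1)))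
... | suc k rewrite ai | suc-injective (trans bi (+-comm x 1)) = begin
  x + y + 1 + 1 ∸ suc x   ≡⟨ cong (_∸ suc x) (+-comm (x + y + 1) 1) ⟩
  suc (x + y + 1) ∸ suc x ≡⟨ cong (λ z → suc z ∸ suc x) (+-assoc x y 1) ⟩
  suc x + (y + 1) ∸ suc x ≡⟨ m+n∸m≡n (suc x) (y + 1) ⟩
  y + 1                   ∎
  where open ≡-Reasoning

dual-support : ∀ {n} (a b : Mon n) i → 1 ≤ (a ∖ₘ b) i → 1 ≤ b i
dual-support a b i pos with b i
... | zero  = pos
... | suc _ = s≤s z≤n

mIdeal-at : ∀ {n} (a b m : Mon n) i {y} → (a ∖ₘ b) i ≡ y + 1 → y + 1 ≤ m i →
  mIdeal (a ∖ₘ b) m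
mIdeal-at a b m i {y} e le = i , subst (1 ≤_) (sym e) (m≤n+m 1 y) , subst (_≤ m i) (sym e) le

module Degrees {n} (G : Graph n) where

  deg : Fin n → ℕ
  deg = degVec G

  outdeg : Orientation G → Fin n → ℕ
  outdeg O i = countB (dir O i)

  degIn : Sub n → Fin n → ℕ
  degIn σ i = countB (λ j → if σ j then adj G i j else false)

  adj-sym : ∀ {i j} → adj G i j ≡ true → adj G j i ≡ true
  adj-sym {i} {j} a = trans (Graph.sym G j i) a

  deg-orientation : ∀ (O : Orientation G) i → deg i ≡ indeg O i + outdeg O i
  deg-orientation O i = countB-split _ _ _ pointwise
    where
    pointwise : ∀ j → toN (adj G i j) ≡ toN (dir O j i) + toN (dir O i j)
    pointwise j with adj G i j in a
    ... | true with total O i j a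
    ...   | inj₁ out rewrite out | antisym O i j out = refl
    ...   | inj₂ in′ rewrite in′ | antisym O j i in′ = refl
    pointwise j | false with dir O j i in d₁ | dir O i j in d₂
    ... | true  | _     = ⊥-elim (true≢false (adj-sym (onEdges O j i d₁)) a)
    ... | false | true  = ⊥-elim (true≢false (onEdges O i j d₂) a)
    ... | false | false = refl

  deg-set : ∀ σ i → deg i ≡ degOut G σ i + degIn σ i
  deg-set σ i = countB-split _ _ _ pointwise
    where
    pointwise : ∀ j → toN (adj G i j) ≡
      toN (if σ j then false else adj G i j) + toN (if σ j then adj G i j else false)
    pointwise j with σ j
    ... | true  = refl
    ... | false = sym (+-identityʳ _)

  indeg≤deg : ∀ (O : Orientation G) i → indeg O i ≤ deg i
  indeg≤deg O i = countB-mono (λ j d → adj-sym (onEdges O j i d))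

  degOut≤deg : ∀ σ i → degOut G σ i ≤ deg i
  degOut≤deg σ i = countB-mono outside⊆N
    where
    outside⊆N : ∀ j → (if σ j then false else adj G i j) ≡ true → adj G i j ≡ true
    outside⊆N j e with σ j
    ... | false = e

  neighbours-agree : ∀ {σ V} i → (∀ j → adj G i j ≡ true → σ j ≡ V j) →
    degOut G σ i ≡ degOut G V i × degIn σ i ≡ degIn V i
  neighbours-agree {σ} {V} i agree = countB-cong outside , countB-cong inside
    where
    outside : ∀ j → (if σ j then false else adj G i j) ≡ (if V j then false else adj G i j)
    outside j with adj G i j in a
    ... | true  = cong (λ b → if b then false else true) (agree j a)
    ... | false = trans (if-same (σ j)) (sym (if-same (V j)))
    inside : ∀ j → (if σ j then adj G i j else false) ≡ (if V j then adj G i j else false)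
    inside j with adj G i j in a
    ... | true  = cong (λ b → if b then true else false) (agree j a)
    ... | false = trans (if-same (σ j)) (sym (if-same (V j)))

module Generators {n} (G : Graph n) where
  open Degrees G

  A-gen : Orientation G → Mon n
  A-gen O i = indeg O i + 1

  sum-indeg≡sum-outdeg : ∀ (O : Orientation G) → sum (indeg O) ≡ sum (outdeg O)
  sum-indeg≡sum-outdeg O = begin
    sum (indeg O)                              ≡⟨ sum-cong-≗ (λ i → countB-sum (λ j → dir O j i)) ⟩
    sum (λ i → sum (λ j → toN (dir O j i)))    ≡⟨ ∑-comm (λ i j → toN (dir O j i)) ⟩
    sum (λ j → sum (λ i → toN (dir O j i)))    ≡⟨ sum-cong-≗ (λ j → sym (countB-sum (dir O j))) ⟩
    sum (outdeg O)                             ∎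
    where open ≡-Reasoning

  indeg-total : ∀ (O : Orientation G) → sum (indeg O) + sum (indeg O) ≡ sum deg
  indeg-total O = begin
    sum (indeg O) + sum (indeg O)       ≡⟨ cong (sum (indeg O) +_) (sum-indeg≡sum-outdeg O) ⟩
    sum (indeg O) + sum (outdeg O)      ≡⟨ ∑-distrib-+ (indeg O) (outdeg O) ⟨
    sum (λ i → indeg O i + outdeg O i)  ≡⟨ sum-cong-≗ (deg-orientation O) ⟨
    sum deg                             ∎
    where open ≡-Reasoning

  indeg-rigid : ∀ (O′ O : Orientation G) → (∀ i → indeg O′ i ≤ indeg O i) →
    ∀ i → indeg O′ i ≡ indeg O i
  indeg-rigid O′ O le =
    sum-rigid _ _ le (+-double-injective (trans (indeg-total O′) (sym (indeg-total O))))

  A-gen-minimal : ∀ O → Acyclic O → MinGen (A-ideal G) (A-gen O)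
  A-gen-minimal O acyclic = (O , acyclic , λ _ → ≤-refl) , minimal
    where
    minimal : ∀ c → A-ideal G c → c ∣ₘ A-gen O → c ≗ₘ A-gen O
    minimal c (O′ , _ , O′∣c) c∣O i =
      ≤-antisym (c∣O i) (subst (λ d → d + 1 ≤ c i) (same i) (O′∣c i))
      where
      same : ∀ i → indeg O′ i ≡ indeg O i
      same = indeg-rigid O′ O (λ i → +-cancelʳ-≤ 1 _ _ (≤-trans (O′∣c i) (c∣O i)))

  A-mingen-form : ∀ b → MinGen (A-ideal G) b →
    Σ (Orientation G) λ O → Acyclic O × (∀ i → b i ≡ A-gen O i)
  A-mingen-form b ((O , acyclic , O∣b) , minimal) =
    O , acyclic , λ i → sym (minimal (A-gen O) (O , acyclic , λ _ → ≤-refl) O∣b i)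

  T-gen-in : ∀ σ i → σ i ≡ true → T-gen G σ i ≡ degOut G σ i + 1
  T-gen-in σ i σi rewrite σi = refl

  T-gen-support : ∀ σ i → 1 ≤ T-gen G σ i → σ i ≡ true
  T-gen-support σ i pos with σ i
  ... | true = refl
  ... | false with pos
  ...   | ()

  T-gen≤ : ∀ σ i → T-gen G σ i ≤ deg i + 1
  T-gen≤ σ i with σ i
  ... | true  = +-monoˡ-≤ 1 (degOut≤deg σ i)
  ... | false = z≤n

  T-gen-cong : ∀ {σ′ σ} → (∀ j → σ′ j ≡ σ j) → ∀ i → T-gen G σ′ i ≡ T-gen G σ i
  T-gen-cong {σ = σ} same i rewrite same i = cong (λ d → if σ i then d + 1 else 0)
    (countB-cong (λ j → cong (λ b → if b then false else adj G i j) (same j)))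

  T-gen-∣⇒⊆ : ∀ {σ′ σ} → T-gen G σ′ ∣ₘ T-gen G σ → σ′ ⊆ σ
  T-gen-∣⇒⊆ {σ′} {σ} div j σ′j =
    T-gen-support σ j (≤-trans (subst (1 ≤_) (sym (T-gen-in σ′ j σ′j)) (m≤n+m 1 _)) (div j))

  degOut-drop : ∀ {σ′ σ u v} → σ′ ⊆ σ → adj G u v ≡ true → σ′ v ≡ false → σ v ≡ true →
    degOut G σ u < degOut G σ′ u
  degOut-drop {σ′} {σ} {u} {v} sub a σ′v σv = countB-strict outside⊆ v
    (subst (λ b → (if b then false else adj G u v) ≡ false) (sym σv) refl)
    (subst (λ b → (if b then false else adj G u v) ≡ true) (sym σ′v) a)
    where
    outside⊆ : (λ l → if σ l then false else adj G u l) ⊆ (λ l → if σ′ l then false else adj G u l)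
    outside⊆ l e with σ l in σl
    ... | false with σ′ l in σ′l
    ...   | false = e
    ...   | true  = ⊥-elim (true≢false (sub l σ′l) σl)

  -- If T-gen σ′ divides T-gen σ, σ′ is nonempty and G[σ] is connected, then
  -- σ′ = σ: otherwise a walk in σ leaves σ′ along an edge uv, and deg^out
  -- at u would be larger for σ′ than for σ.
  T-gen-rigid : ∀ {σ′ σ} → (∃ λ i → σ′ i ≡ true) → InducedConnected G σ →
    T-gen G σ′ ∣ₘ T-gen G σ → ∀ j → σ′ j ≡ σ j
  T-gen-rigid {σ′} {σ} (i₁ , σ′i₁) connected div j = bool-ext (sub j) inσ′
    where
    sub : σ′ ⊆ σ
    sub = T-gen-∣⇒⊆ div
    no-exit : ExitEdge {G = G} σ σ′ → ⊥
    no-exit (u , v , σ′u , σ′v , σv , a) = <⇒≱ (degOut-drop sub a σ′v σv)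
      (+-cancelʳ-≤ 1 _ _ (subst₂ _≤_ (T-gen-in σ′ u σ′u) (T-gen-in σ u (sub u σ′u)) (div u)))
    inσ′ : σ j ≡ true → σ′ j ≡ true
    inσ′ σj with σ′ j in σ′j
    ... | true  = refl
    ... | false = ⊥-elim (no-exit (walk-exit (connected i₁ j (sub i₁ σ′i₁) σj) σ′i₁ σ′j))

  T-gen-minimal : ∀ σ → (∃ λ i → σ i ≡ true) → InducedConnected G σ →
    MinGen (T-ideal G) (T-gen G σ)
  T-gen-minimal σ nonempty connected = (σ , nonempty , connected , λ _ → ≤-refl) , minimal
    where
    minimal : ∀ c → T-ideal G c → c ∣ₘ T-gen G σ → c ≗ₘ T-gen G σ
    minimal c (σ′ , nonempty′ , _ , σ′∣c) c∣σ i =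
      ≤-antisym (c∣σ i) (subst (_≤ c i) (T-gen-cong same i) (σ′∣c i))
      where
      same : ∀ j → σ′ j ≡ σ j
      same = T-gen-rigid nonempty′ connected (λ j → ≤-trans (σ′∣c j) (c∣σ j))

  T-mingen-form : ∀ b → MinGen (T-ideal G) b → Σ (Sub n) λ σ →
    (∃ λ i → σ i ≡ true) × InducedConnected G σ × (∀ i → b i ≡ T-gen G σ i)
  T-mingen-form b ((σ , nonempty , connected , σ∣b) , minimal) =
    σ , nonempty , connected ,
    λ i → sym (minimal (T-gen G σ) (σ , nonempty , connected , λ _ → ≤-refl) σ∣b i)

module Duality {n} (G : Graph n) where
  open Degrees G
  open Generators G

  a : Mon n
  a = degVec+1 G

  dual-of-A-gen : ∀ b (O : Orientation G) i → b i ≡ A-gen O i → (a ∖ₘ b) i ≡ outdeg O i + 1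
  dual-of-A-gen b O i bi = dual-exponent a b i (cong (_+ 1) (deg-orientation O i)) bi

  dual-of-T-gen : ∀ b σ i → σ i ≡ true → b i ≡ T-gen G σ i → (a ∖ₘ b) i ≡ degIn σ i + 1
  dual-of-T-gen b σ i σi bi =
    dual-exponent a b i (cong (_+ 1) (deg-set σ i)) (trans bi (T-gen-in σ i σi))

  -- All minimal generators divide x^a, so the duals are defined.
  A-gens-divide : ∀ b → MinGen (A-ideal G) b → b ∣ₘ a
  A-gens-divide b b-min i with A-mingen-form b b-min
  ... | O , _ , b≡ = subst (_≤ a i) (sym (b≡ i)) (+-monoˡ-≤ 1 (indeg≤deg O i))

  T-gens-divide : ∀ b → MinGen (T-ideal G) b → b ∣ₘ a
  T-gens-divide b b-min i with T-mingen-form b b-min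
  ... | σ , _ , _ , b≡ = subst (_≤ a i) (sym (b≡ i)) (T-gen≤ σ i)

  -- At a sink s of σ, every out-neighbour of s lies outside σ ...
  sink-outdeg : ∀ (O : Orientation G) {σ s} → IsSink O σ s → outdeg O s ≤ degOut G σ s
  sink-outdeg O {σ} {s} (_ , no-arc) = countB-mono out⊆outside
    where
    out⊆outside : ∀ j → dir O s j ≡ true → (if σ j then false else adj G s j) ≡ true
    out⊆outside j d with σ j in σj
    ... | true  = ⊥-elim (true≢false d (no-arc j σj))
    ... | false = onEdges O s j d

  -- ... and every neighbour of s inside σ is an in-neighbour.
  sink-degIn : ∀ (O : Orientation G) {σ s} → IsSink O σ s → degIn σ s ≤ indeg O s
  sink-degIn O {σ} {s} (_ , no-arc) = countB-mono inside⊆in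
    where
    inside⊆in : ∀ j → (if σ j then adj G s j else false) ≡ true → dir O j s ≡ true
    inside⊆in j e with σ j in σj
    ... | true with total O s j e
    ...   | inj₁ d = ⊥-elim (true≢false d (no-arc j σj))
    ...   | inj₂ d = d

  -- T_G ⊆ A_G^[a]: the sink s of O in σ witnesses membership in m^(a ∖ A-gen O).
  T⊆dualA : ∀ m → T-ideal G m → AlexDual (A-ideal G) a m
  T⊆dualA m (σ , (i₀ , σi₀) , _ , σ∣m) b b-min with A-mingen-form b b-min
  ... | O , acyclic , b≡ with sink O acyclic σ i₀ σi₀
  ...   | s , is-sink = mIdeal-at a b m s (dual-of-A-gen b O s (b≡ s))
          (≤-trans (+-monoˡ-≤ 1 (sink-outdeg O is-sink))
                   (subst (_≤ m s) (T-gen-in σ s (proj₁ is-sink)) (σ∣m s)))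

  -- A_G ⊆ T_G^[a]: the sink s of O in σ witnesses membership in m^(a ∖ T-gen σ).
  A⊆dualT : ∀ m → A-ideal G m → AlexDual (T-ideal G) a m
  A⊆dualT m (O , acyclic , O∣m) b b-min with T-mingen-form b b-min
  ... | σ , (i₀ , σi₀) , _ , b≡ with sink O acyclic σ i₀ σi₀
  ...   | s , is-sink = mIdeal-at a b m s (dual-of-T-gen b σ s (proj₁ is-sink) (b≡ s))
          (≤-trans (+-monoˡ-≤ 1 (sink-degIn O is-sink)) (O∣m s))

  -- In the orientation by rank, a neighbour j of i outside a set containing
  -- every vertex of rank ≤ rank i is an out-neighbour of i, and every
  -- in-neighbour of i lies in that set.
  module _ (rank : Fin n → ℕ) (injective : ∀ i j → rank i ≡ rank j → i ≡ j) where
    open RankOrientation G rank injective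

    rank-degOut : ∀ {V} i → (∀ j → rank j ≤ rank i → V j ≡ true) → degOut G V i ≤ outdeg byRank i
    rank-degOut {V} i below⊆V = countB-mono outside⊆out
      where
      outside⊆out : ∀ j → (if V j then false else adj G i j) ≡ true → dir byRank i j ≡ true
      outside⊆out j e with V j in Vj
      ... | false = ∧-intro e (<ᵇ-complete (≰⇒> (λ le → true≢false (below⊆V j le) Vj)))

    rank-indeg : ∀ {V} i → (∀ j → rank j ≤ rank i → V j ≡ true) → indeg byRank i ≤ degIn V i
    rank-indeg {V} i below⊆V = countB-mono in⊆inside
      where
      in⊆inside : ∀ j → dir byRank j i ≡ true → (if V j then adj G i j else false) ≡ true
      in⊆inside j d rewrite below⊆V j (<⇒≤ (arc-rank d)) = adj-sym (∧-conicalˡ _ _ d)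

  -- Peel i from V while m_i ≤ deg^out_V(i).  A complete
  -- peeling gives an acyclic orientation O with m_i ≤ outdeg_O(i) for all i,
  -- so x^m ∉ m^(a ∖ A-gen O); a blocking set V gives, via the component σ of
  -- any of its vertices, T-gen σ ∣ x^m.
  module DualA (m : Mon n) where
    open Peeling (λ V i → m i ≤ degOut G V i) (λ V i → m i ≤? degOut G V i)

    blocking⇒T : ∀ {V} → Blocking V → T-ideal G m
    blocking⇒T {V} ((i₀ , Vi₀) , blocked) =
      component , (i₀ , i₀∈component) , component-connected , σ∣m
      where
      open Component G V i₀ Vi₀
      σ∣m : T-gen G component ∣ₘ m
      σ∣m i with component i in σi
      ... | false = z≤n
      ... | true  = subst (λ d → d + 1 ≤ m i)
          (sym (proj₁ (neighbours-agree i (λ j → component-agrees σi))))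
          (subst (_≤ m i) (+-comm 1 _) (≰⇒> (blocked i (component⊆V i σi))))

    peeling⇒¬dual : PeelingOrder (λ _ → true) n → ¬ AlexDual (A-ideal G) a m
    peeling⇒¬dual order m∈dual = absurd
      where
      open PeelingOrder order
      injective′ : ∀ i j → rank i ≡ rank j → i ≡ j
      injective′ i j = injective i j refl refl
      open RankOrientation G rank injective′
      absurd : ⊥
      absurd with m∈dual (A-gen byRank) (A-gen-minimal byRank byRank-acyclic)
      ... | i , _ , dual≤m with peel i refl
      ...   | V , below⊆V , m≤degOut = <-irrefl refl (begin-strict
        m i                            ≤⟨ m≤degOut ⟩
        degOut G V i                   ≤⟨ rank-degOut rank injective′ i (λ j → below⊆V j refl) ⟩
        outdeg byRank i                <⟨ m<m+n _ (s≤s z≤n) ⟩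
        outdeg byRank i + 1            ≡⟨ dual-of-A-gen (A-gen byRank) byRank i refl ⟨
        (a ∖ₘ A-gen byRank) i          ≤⟨ dual≤m ⟩
        m i                            ∎)
        where open ≤-Reasoning

    dualA⊆T : AlexDual (A-ideal G) a m → T-ideal G m
    dualA⊆T m∈dual with peeling
    ... | inj₁ (V , blocking) = blocking⇒T blocking
    ... | inj₂ order          = ⊥-elim (peeling⇒¬dual order m∈dual)

  -- Peel i from V while |N(i) ∩ V| + 1 ≤ m_i.  A complete
  -- peeling gives an acyclic orientation O with A-gen O ∣ x^m; a blocking set V
  -- yields a component σ with x^m ∉ m^(a ∖ T-gen σ).
  module DualT (m : Mon n) where
    open Peeling (λ V i → degIn V i + 1 ≤ m i) (λ V i → degIn V i + 1 ≤? m i)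

    peeling⇒A : PeelingOrder (λ _ → true) n → A-ideal G m
    peeling⇒A order = byRank , byRank-acyclic , O∣m
      where
      open PeelingOrder order
      injective′ : ∀ i j → rank i ≡ rank j → i ≡ j
      injective′ i j = injective i j refl refl
      open RankOrientation G rank injective′
      O∣m : A-gen byRank ∣ₘ m
      O∣m i with peel i refl
      ... | V , below⊆V , degIn<m =
        ≤-trans (+-monoˡ-≤ 1 (rank-indeg rank injective′ i (λ j → below⊆V j refl))) degIn<m

    blocking⇒¬dual : ∀ {V} → Blocking V → ¬ AlexDual (T-ideal G) a m
    blocking⇒¬dual {V} ((i₀ , Vi₀) , blocked) m∈dual = absurd
      where
      open Component G V i₀ Vi₀
      absurd : ⊥
      absurd with m∈dual (T-gen G component)
                         (T-gen-minimal component (i₀ , i₀∈component) component-connected)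
      ... | i , positive , dual≤m = blocked i (component⊆V i σi) (begin
        degIn V i + 1               ≡⟨ cong (_+ 1) same-degIn ⟨
        degIn component i + 1       ≡⟨ dual-of-T-gen (T-gen G component) component i σi refl ⟨
        (a ∖ₘ T-gen G component) i  ≤⟨ dual≤m ⟩
        m i                         ∎)
        where
        open ≤-Reasoning
        σi : component i ≡ true
        σi = T-gen-support component i (dual-support a (T-gen G component) i positive)
        same-degIn : degIn component i ≡ degIn V i
        same-degIn = proj₂ (neighbours-agree i (λ j → component-agrees σi))

    dualT⊆A : AlexDual (T-ideal G) a m → A-ideal G m
    dualT⊆A m∈dual with peeling
    ... | inj₁ (V , blocking) = ⊥-elim (blocking⇒¬dual blocking m∈dual)
    ... | inj₂ order          = peeling⇒A order

theorem3p6 : ∀ {n} (G : Graph n) → Connected G →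
    (∀ b → MinGen (A-ideal G) b → b ∣ₘ degVec+1 G) ×
    (∀ b → MinGen (T-ideal G) b → b ∣ₘ degVec+1 G) ×
    (AlexDual (A-ideal G) (degVec+1 G) ≐ T-ideal G) ×
    (AlexDual (T-ideal G) (degVec+1 G) ≐ A-ideal G)
theorem3p6 G _ =
  A-gens-divide , T-gens-divide ,
  (λ m → DualA.dualA⊆T m , T⊆dualA m) ,
  (λ m → DualT.dualT⊆A m , A⊆dualT m)
  where open Duality G
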